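{- Let $\mathcal F\subseteq\mathcal P([n])$ be $\mathcal N$-saturated and let $\mathcal G$ be a component of $\mathcal F$, with minimal elements $B_1,\dots,B_l$ and maximal elements $A_1,\dots,A_k$. Let $M\in\mathcal F$ be such that $\bigcup_{i=1}^lB_i\subseteq M\subseteq\bigcap_{i=1}^kA_i$, and such that $M$ is maximal (under inclusion) among elements of $\mathcal F$ with this property. Then every $X\in\mathcal G$ is comparable to $M$.
   Context: $[n]=\{1,\dots,n\}$, $\mathcal P([n])$ its power set ordered by inclusion. The poset $\mathcal N$ has four elements $a,b,c,d$ with $a<c$, $b<c$, $b<d$ and no other comparabilities. A family contains an induced copy of $\mathcal N$ if it contains distinct sets $P,Q,R,S$ with $P\subset R$, $Q\subset R$, $Q\subset S$ and each of the pairs $\{P,Q\},\{P,S\},\{R,S\}$ incomparable. $\mathcal F$ is $\mathcal N$-saturated if it contains no induced copy of $\mathcal N$ but $\mathcal F\cup\{X\}$ contains one for every $X\in\mathcal P([n])\setminus\mathcal F$. A component of $\mathcal F$ is the vertex set of a connected component of the Hasse diagram of $(\mathcal F\setminus\{\emptyset,[n]\},\subseteq)$ viewed as an undirected graph; its minimal and maximal elements are taken with respect to inclusion within the component. -}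

module Defs where

open import Data.Nat using (ℕ)
open import Data.Product using (_×_; Σ; ∃; _,_)
open import Data.Sum using (_⊎_)
open import Data.List using (List; _∷_)
open import Data.List.Membership.Propositional using (_∈_; _∉_)
open import Relation.Nullary using (¬_)
open import Relation.Binary.PropositionalEquality using (_≡_; _≢_)
open import Data.Fin.Subset using (Subset; _⊆_; _⊂_)
  renaming (⊥ to ∅; ⊤ to Full)

-- A family of subsets of [n], given as a finite list (duplicates irrelevant;
-- membership is list membership).
Family : ℕ → Set
Family n = List (Subset n)

Incomparable : ∀ {n} → Subset n → Subset n → Set
Incomparable A B = ¬ (A ⊆ B) × ¬ (B ⊆ A)

ContainsInducedN : ∀ {n} → Family n → Set
ContainsInducedN {n} 𝓕 =
  Σ (Subset n) λ P → Σ (Subset n) λ Q → Σ (Subset n) λ R → Σ (Subset n) λ S →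
    (P ∈ 𝓕) × (Q ∈ 𝓕) × (R ∈ 𝓕) × (S ∈ 𝓕) ×
    (P ≢ Q) × (P ≢ R) × (P ≢ S) × (Q ≢ R) × (Q ≢ S) × (R ≢ S) ×
    (P ⊂ R) × (Q ⊂ R) × (Q ⊂ S) ×
    Incomparable P Q × Incomparable P S × Incomparable R S

NSaturated : ∀ {n} → Family n → Set
NSaturated {n} 𝓕 =
  ¬ ContainsInducedN 𝓕 ×
  ((X : Subset n) → X ∉ 𝓕 → ContainsInducedN (X ∷ 𝓕))

Vertex : ∀ {n} → Family n → Subset n → Set
Vertex 𝓕 X = X ∈ 𝓕 × X ≢ ∅ × X ≢ Full

Covers : ∀ {n} → Family n → Subset n → Subset n → Set
Covers {n} 𝓕 A B =
  Vertex 𝓕 A × Vertex 𝓕 B × A ⊂ B ×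
  ((C : Subset n) → Vertex 𝓕 C → ¬ (A ⊂ C × C ⊂ B))

HasseEdge : ∀ {n} → Family n → Subset n → Subset n → Set
HasseEdge 𝓕 A B = Covers 𝓕 A B ⊎ Covers 𝓕 B A

data Connected {n} (𝓕 : Family n) : Subset n → Subset n → Set where
  here : ∀ {X} → Vertex 𝓕 X → Connected 𝓕 X X
  step : ∀ {X Y Z} → HasseEdge 𝓕 X Y → Connected 𝓕 Y Z → Connected 𝓕 X Z

InComponent : ∀ {n} → Family n → Subset n → Subset n → Set
InComponent 𝓕 V X = Connected 𝓕 V X

MinimalIn : ∀ {n} → Family n → Subset n → Subset n → Set
MinimalIn {n} 𝓕 V B =
  InComponent 𝓕 V B × ((Y : Subset n) → InComponent 𝓕 V Y → ¬ (Y ⊂ B))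

MaximalIn : ∀ {n} → Family n → Subset n → Subset n → Set
MaximalIn {n} 𝓕 V A =
  InComponent 𝓕 V A × ((Y : Subset n) → InComponent 𝓕 V Y → ¬ (A ⊂ Y))

Between : ∀ {n} → Family n → Subset n → Subset n → Set
Between {n} 𝓕 V M =
  ((B : Subset n) → MinimalIn 𝓕 V B → B ⊆ M) ×
  ((A : Subset n) → MaximalIn 𝓕 V A → M ⊆ A)

{-# OPTIONS --safe #-}
module Submission where

-- Suppose X ∈ 𝒢 is incomparable to M, and call Z ∈ 𝓕 sandwiched when it lies
-- between all minimal and all maximal elements of 𝒢. If W ∈ 𝒢 escapes a maximal
-- element A₀ of 𝒢, then W contains every sandwiched Z: otherwise W, Z, a maximal
-- element above W and A₀ form an induced 𝒩 (dually below). Hence every W ∈ 𝒢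
-- that is neither a lower nor an upper bound of the sandwiched sets is itself
-- sandwiched; this applies to X, and to every W ∈ 𝒢 incomparable to the join Y
-- of the sandwiched sets. So Y is comparable to all of 𝒢, and Y is sandwiched,
-- whence Y ∉ 𝓕 by maximality of M (X ⊆ Y but X ⊈ M). Saturation gives an
-- induced 𝒩 through Y, and replacing Y by M or by a maximal element of 𝒢 moves
-- it into 𝓕.

open import Defs
open import Data.Nat using (ℕ)
open import Data.Bool.Properties using () renaming (_≟_ to _≟ᵇ_)
open import Data.Empty using (⊥-elim)
open import Data.Fin.Properties using (any?)
open import Data.Fin.Subset using (Subset; _⊆_; _⊂_; _⊃_; _∪_)
  renaming (⊥ to ∅; ⊤ to Full)
open import Data.Fin.Subset.Properties
  using (_∈?_; _⊆?_; _⊂?_; ⊆-refl; ⊆-trans; ⊆-antisym; ⊂-irref; ⊂-⊆-trans; ⊆-⊂-trans;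
         p⊂q⇒p⊆q; ⊥⊆; ⊆⊤; p⊆p∪q; q⊆p∪q; x∈p∪q⁻)
open import Data.Fin.Subset.Induction using (Acc; acc; ⊂-wellFounded; ⊃-wellFounded)
open import Data.List using (List; []; _∷_)
open import Data.List.Membership.Propositional using (_∈_; find; lose)
import Data.List.Membership.DecPropositional as DecMembership
open import Data.List.Relation.Unary.Any using (here; there; tail)
  renaming (any? to anyᴸ?)
open import Data.Product using (_×_; ∃; _,_; proj₁; proj₂; swap)
open import Data.Sum using (_⊎_; inj₁; inj₂; [_,_]′)
import Data.Sum as Sum
open import Data.Vec.Properties using (≡-dec)
open import Function using (_∘_)
open import Effect.Monad using (RawMonad)
open import Level using (0ℓ)
open import Induction.WellFounded using (WellFounded)
open import Relation.Binary using (Rel; Decidable)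
open import Relation.Binary.PropositionalEquality using (_≡_; _≢_; refl; sym; subst)
open import Relation.Nullary using (¬_; Dec; yes; no; contradiction)
open import Relation.Nullary.Decidable using (_×-dec_; ¬?; decidable-stable; ¬¬-excluded-middle)
open import Relation.Nullary.Negation using (¬¬-Monad)
import Relation.Unary as U

private
  variable
    n : ℕ
    p q : Subset n

_≟_ : (p q : Subset n) → Dec (p ≡ q)
_≟_ = ≡-dec _≟ᵇ_

⊆∧⊉⇒⊂ : p ⊆ q → ¬ q ⊆ p → p ⊂ q
⊆∧⊉⇒⊂ {p = p} {q} p⊆q q⊈p with any? (λ i → i ∈? q ×-dec ¬? (i ∈? p))
... | yes (i , i∈q , i∉p) = p⊆q , i , i∈q , i∉p
... | no ∄ = contradiction (λ {i} i∈q → decidable-stable (_ ∈? p) (λ i∉p → ∄ (_ , i∈q , i∉p))) q⊈p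

Incomparable⇒≢ : Incomparable p q → p ≢ q
Incomparable⇒≢ (p⊈q , _) refl = p⊈q ⊆-refl

Incomparable⇒Vertex : {F : Family n} → p ∈ F → Incomparable p q → Vertex F p
Incomparable⇒Vertex p∈F (p⊈q , q⊈p) = p∈F , (λ { refl → p⊈q ⊥⊆ }) , (λ { refl → q⊈p ⊆⊤ })

Vertex-between : {F : Family n} {B M A : Subset n} → Vertex F B → Vertex F A →
  M ∈ F → B ⊆ M → M ⊆ A → Vertex F M
Vertex-between (_ , B≢∅ , _) (_ , _ , A≢Full) M∈ B⊆M M⊆A =
  M∈ , (λ { refl → B≢∅ (⊆-antisym B⊆M ⊥⊆) }) , (λ { refl → A≢Full (⊆-antisym ⊆⊤ M⊆A) })

inducedN : {F : Family n} {P Q R S : Subset n} → P ∈ F → Q ∈ F → R ∈ F → S ∈ F →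
  P ⊂ R → Q ⊂ R → Q ⊂ S → Incomparable P Q → Incomparable P S → Incomparable R S →
  ContainsInducedN F
inducedN P∈ Q∈ R∈ S∈ P⊂R Q⊂R Q⊂S P∥Q P∥S R∥S =
  _ , _ , _ , _ , P∈ , Q∈ , R∈ , S∈ ,
  Incomparable⇒≢ P∥Q , ⊂⇒≢ P⊂R , Incomparable⇒≢ P∥S ,
  ⊂⇒≢ Q⊂R , ⊂⇒≢ Q⊂S , Incomparable⇒≢ R∥S ,
  P⊂R , Q⊂R , Q⊂S , P∥Q , P∥S , R∥S
  where
  ⊂⇒≢ : p ⊂ q → p ≢ q
  ⊂⇒≢ p⊂q p≡q = ⊂-irref p≡q p⊂q

Minimal : {A : Set} → Rel A 0ℓ → U.Pred A 0ℓ → U.Pred A 0ℓ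
Minimal _<_ P x = P x × (∀ {y} → P y → ¬ y < x)

∃-minimal : {A : Set} {_<_ : Rel A 0ℓ} → WellFounded _<_ → Decidable _<_ →
  {P : U.Pred A 0ℓ} → U.Decidable P → (xs : List A) →
  ∀ {x} → x ∈ xs → P x → ∃ (Minimal _<_ (λ y → y ∈ xs × P y))
∃-minimal {_<_ = _<_} <-wf _<?_ {P} P? xs {x} = go (<-wf x)
  where
  go : ∀ {x} → Acc _<_ x → x ∈ xs → P x → ∃ (Minimal _<_ (λ y → y ∈ xs × P y))
  go {x} (acc rs) x∈ Px with anyᴸ? (λ y → P? y ×-dec y <? x) xs
  ... | yes below = let y , y∈ , Py , y<x = find below in go (rs y<x) y∈ Py
  ... | no ∄below = x , (x∈ , Px) , λ (y∈ , Py) y<x → ∄below (lose y∈ (Py , y<x))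

IsJoin : U.Pred (Subset n) 0ℓ → Subset n → Set
IsJoin P U = (∀ {Z} → P Z → Z ⊆ U) × (∀ {W} → (∀ {Z} → P Z → Z ⊆ W) → U ⊆ W)

-- Membership in P need not be decidable, hence the join exists only classically.
¬¬-join : (P : U.Pred (Subset n) 0ℓ) (xs : List (Subset n)) →
  ¬ ¬ ∃ (IsJoin (λ Z → Z ∈ xs × P Z))
¬¬-join P [] ∄join = ∄join (∅ , (λ { (() , _) }) , λ _ → ⊥⊆)
¬¬-join P (x ∷ xs) = do
    U , U-join ← ¬¬-join P xs
    Px? ← ¬¬-excluded-middle
    return (extend U U-join Px?)
  where
  open RawMonad ¬¬-Monad
  extend : ∀ U → IsJoin (λ Z → Z ∈ xs × P Z) U → Dec (P x) → ∃ (IsJoin (λ Z → Z ∈ x ∷ xs × P Z))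
  extend U (upper , least) (yes Px) =
    x ∪ U
    , (λ { (here refl , _) → p⊆p∪q U ; (there Z∈ , PZ) → ⊆-trans (upper (Z∈ , PZ)) (q⊆p∪q x U) })
    , λ bound i∈ → [ bound (here refl , Px) , least (λ (Z∈ , PZ) → bound (there Z∈ , PZ)) ]′
                     (x∈p∪q⁻ x U i∈)
  extend U (upper , least) (no ¬Px) =
    U
    , (λ { (here refl , Px) → contradiction Px ¬Px ; (there Z∈ , PZ) → upper (Z∈ , PZ) })
    , λ bound → least (λ (Z∈ , PZ) → bound (there Z∈ , PZ))

module HasseDiagram {n} (F : Family n) where

  open DecMembership (_≟_ {n}) using () renaming (_∈?_ to _∈F?_)

  vertex? : U.Decidable (Vertex F)
  vertex? C = C ∈F? F ×-dec ¬? (C ≟ ∅) ×-dec ¬? (C ≟ Full)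

  private
    variable
      V W X Y Z : Subset n

  Connected-source : Connected F X Y → Vertex F X
  Connected-source (here vX) = vX
  Connected-source (step (inj₁ X⋖Y) _) = proj₁ X⋖Y
  Connected-source (step (inj₂ Y⋖X) _) = proj₁ (proj₂ Y⋖X)

  Connected-target : Connected F X Y → Vertex F Y
  Connected-target (here vX) = vX
  Connected-target (step _ c) = Connected-target c

  Connected-trans : Connected F X Y → Connected F Y Z → Connected F X Z
  Connected-trans (here _) d = d
  Connected-trans (step e c) d = step e (Connected-trans c d)

  Connected-sym : Connected F X Y → Connected F Y X
  Connected-sym (here vX) = here vX
  Connected-sym (step e c) =
    Connected-trans (Connected-sym c) (step (Sum.swap e) (here (Connected-source (step e c))))

  -- A ⊂-minimal vertex C with Y ⊂ C ⊆ Z covers Y; recurse from C.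
  ⊆⇒Connected : Vertex F Y → Vertex F Z → Y ⊆ Z → Connected F Y Z
  ⊆⇒Connected {Y} vY = go (⊃-wellFounded Y) vY
    where
    go : ∀ {Y Z} → Acc _⊃_ Y → Vertex F Y → Vertex F Z → Y ⊆ Z → Connected F Y Z
    go {Y} {Z} (acc rs) vY vZ Y⊆Z with Z ⊆? Y
    ... | yes Z⊆Y with refl ← ⊆-antisym Y⊆Z Z⊆Y = here vY
    ... | no Z⊈Y
      with C , (_ , vC , Y⊂C , C⊆Z) , minimal ←
             ∃-minimal ⊂-wellFounded _⊂?_ (λ C → vertex? C ×-dec Y ⊂? C ×-dec C ⊆? Z) F
               (proj₁ vZ) (vZ , ⊆∧⊉⇒⊂ Y⊆Z Z⊈Y , ⊆-refl)
      = step (inj₁ (vY , vC , Y⊂C , Y⋖C)) (go (rs Y⊂C) vC vZ C⊆Z)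
      where
      Y⋖C : ∀ D → Vertex F D → ¬ (Y ⊂ D × D ⊂ C)
      Y⋖C D vD (Y⊂D , D⊂C) = minimal (proj₁ vD , vD , Y⊂D , ⊆-trans (p⊂q⇒p⊆q D⊂C) C⊆Z) D⊂C

  InComponent⇒∈ : InComponent F V W → W ∈ F
  InComponent⇒∈ cW = proj₁ (Connected-target cW)

  InComponent-upward : InComponent F V W → Vertex F Z → W ⊆ Z → InComponent F V Z
  InComponent-upward cW vZ W⊆Z = Connected-trans cW (⊆⇒Connected (Connected-target cW) vZ W⊆Z)

  InComponent-downward : InComponent F V W → Vertex F Z → Z ⊆ W → InComponent F V Z
  InComponent-downward cW vZ Z⊆W =
    Connected-trans cW (Connected-sym (⊆⇒Connected vZ (Connected-target cW) Z⊆W))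

  maximal-above : InComponent F V W → ∃ λ A → MaximalIn F V A × W ⊆ A
  maximal-above {W = W} cW
    with A , (_ , vA , W⊆A) , maximal ←
           ∃-minimal ⊃-wellFounded (λ A B → B ⊂? A) (λ C → vertex? C ×-dec W ⊆? C) F
             (proj₁ (Connected-target cW)) (Connected-target cW , ⊆-refl)
    = A , (InComponent-upward cW vA W⊆A , ¬A⊂) , W⊆A
    where
    ¬A⊂ : ∀ Y → InComponent F _ Y → ¬ A ⊂ Y
    ¬A⊂ Y cY A⊂Y = let vY = Connected-target cY in
      maximal (proj₁ vY , vY , ⊆-trans W⊆A (p⊂q⇒p⊆q A⊂Y)) A⊂Y

  minimal-below : InComponent F V W → ∃ λ B → MinimalIn F V B × B ⊆ W
  minimal-below {W = W} cW
    with B , (_ , vB , B⊆W) , minimal ←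
           ∃-minimal ⊂-wellFounded _⊂?_ (λ C → vertex? C ×-dec C ⊆? W) F
             (proj₁ (Connected-target cW)) (Connected-target cW , ⊆-refl)
    = B , (InComponent-downward cW vB B⊆W , ¬⊂B) , B⊆W
    where
    ¬⊂B : ∀ Y → InComponent F _ Y → ¬ Y ⊂ B
    ¬⊂B Y cY Y⊂B = let vY = Connected-target cY in
      minimal (proj₁ vY , vY , ⊆-trans (p⊂q⇒p⊆q Y⊂B) B⊆W) Y⊂B

Sandwiched : Family n → Subset n → U.Pred (Subset n) 0ℓ
Sandwiched F V Z = Z ∈ F × Between F V Z

module NFree {n} {F : Family n} (noN : ¬ ContainsInducedN F) (V : Subset n) where

  open HasseDiagram F

  private
    variable
      A₀ B₀ W Z : Subset n

  ⊈maximal⇒⊇sandwiched : InComponent F V W → MaximalIn F V A₀ → ¬ W ⊆ A₀ →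
                          Sandwiched F V Z → Z ⊆ W
  ⊈maximal⇒⊇sandwiched {W} {A₀} {Z} cW mA₀ W⊈A₀ (Z∈ , btZ)
    with A₁ , mA₁ , W⊆A₁ ← maximal-above cW =
    decidable-stable (Z ⊆? W) λ Z⊈W →
      noN (inducedN (InComponent⇒∈ cW) Z∈ (InComponent⇒∈ (proj₁ mA₁)) (InComponent⇒∈ (proj₁ mA₀))
             (⊆∧⊉⇒⊂ W⊆A₁ (λ A₁⊆W → Z⊈W (⊆-trans Z⊆A₁ A₁⊆W)))
             (⊆∧⊉⇒⊂ Z⊆A₁ (λ A₁⊆Z → A₁⊈A₀ (⊆-trans A₁⊆Z Z⊆A₀)))
             (⊆∧⊉⇒⊂ Z⊆A₀ (λ A₀⊆Z → A₀⊈A₁ (⊆-trans A₀⊆Z Z⊆A₁)))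
             ((λ W⊆Z → W⊈A₀ (⊆-trans W⊆Z Z⊆A₀)) , Z⊈W)
             (W⊈A₀ , λ A₀⊆W → A₀⊈A₁ (⊆-trans A₀⊆W W⊆A₁))
             (A₁⊈A₀ , A₀⊈A₁))
    where
    Z⊆A₀ : Z ⊆ A₀
    Z⊆A₀ = proj₂ btZ A₀ mA₀
    Z⊆A₁ : Z ⊆ A₁
    Z⊆A₁ = proj₂ btZ A₁ mA₁
    A₁⊈A₀ : ¬ A₁ ⊆ A₀
    A₁⊈A₀ A₁⊆A₀ = W⊈A₀ (⊆-trans W⊆A₁ A₁⊆A₀)
    A₀⊈A₁ : ¬ A₀ ⊆ A₁
    A₀⊈A₁ A₀⊆A₁ = proj₂ mA₀ A₁ (proj₁ mA₁) (⊆∧⊉⇒⊂ A₀⊆A₁ A₁⊈A₀)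

  ⊉minimal⇒⊆sandwiched : InComponent F V W → MinimalIn F V B₀ → ¬ B₀ ⊆ W →
                          Sandwiched F V Z → W ⊆ Z
  ⊉minimal⇒⊆sandwiched {W} {B₀} {Z} cW mB₀ B₀⊈W (Z∈ , btZ)
    with B₁ , mB₁ , B₁⊆W ← minimal-below cW =
    decidable-stable (W ⊆? Z) λ W⊈Z →
      noN (inducedN (InComponent⇒∈ (proj₁ mB₀)) (InComponent⇒∈ (proj₁ mB₁)) Z∈ (InComponent⇒∈ cW)
             (⊆∧⊉⇒⊂ B₀⊆Z (λ Z⊆B₀ → B₁⊈B₀ (⊆-trans B₁⊆Z Z⊆B₀)))
             (⊆∧⊉⇒⊂ B₁⊆Z (λ Z⊆B₁ → B₀⊈B₁ (⊆-trans B₀⊆Z Z⊆B₁)))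
             (⊆∧⊉⇒⊂ B₁⊆W (λ W⊆B₁ → W⊈Z (⊆-trans W⊆B₁ B₁⊆Z)))
             (B₀⊈B₁ , B₁⊈B₀)
             (B₀⊈W , λ W⊆B₀ → B₁⊈B₀ (⊆-trans B₁⊆W W⊆B₀))
             ((λ Z⊆W → B₀⊈W (⊆-trans B₀⊆Z Z⊆W)) , W⊈Z))
    where
    B₀⊆Z : B₀ ⊆ Z
    B₀⊆Z = proj₁ btZ B₀ mB₀
    B₁⊆Z : B₁ ⊆ Z
    B₁⊆Z = proj₁ btZ B₁ mB₁
    B₀⊈B₁ : ¬ B₀ ⊆ B₁
    B₀⊈B₁ B₀⊆B₁ = B₀⊈W (⊆-trans B₀⊆B₁ B₁⊆W)
    B₁⊈B₀ : ¬ B₁ ⊆ B₀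
    B₁⊈B₀ B₁⊆B₀ = proj₂ mB₀ B₁ (proj₁ mB₁) (⊆∧⊉⇒⊂ B₁⊆B₀ B₀⊈B₁)

  neither-bound⇒Between : InComponent F V W →
    ¬ (∀ {Z} → Sandwiched F V Z → W ⊆ Z) → ¬ (∀ {Z} → Sandwiched F V Z → Z ⊆ W) →
    Between F V W
  neither-bound⇒Between {W} cW ¬lower ¬upper =
      (λ B mB → decidable-stable (B ⊆? W) λ B⊈W → ¬lower (⊉minimal⇒⊆sandwiched cW mB B⊈W))
    , (λ A mA → decidable-stable (W ⊆? A) λ W⊈A → ¬upper (⊈maximal⇒⊇sandwiched cW mA W⊈A))

module JoinOfSandwiched
  {n} {F : Family n} (noN : ¬ ContainsInducedN F) {V : Subset n} (vV : Vertex F V)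
  {M : Subset n} (M∈ : M ∈ F) (btM : Between F V M)
  (maxM : (M′ : Subset n) → M′ ∈ F → Between F V M′ → M ⊆ M′ → M′ ≡ M)
  {X : Subset n} (cX : InComponent F V X) (X⊈M : ¬ X ⊆ M) (M⊈X : ¬ M ⊆ X)
  {Y : Subset n} (Y-join : IsJoin (Sandwiched F V) Y) where

  open HasseDiagram F
  open NFree noN V

  private
    upper : ∀ {Z} → Sandwiched F V Z → Z ⊆ Y
    upper = proj₁ Y-join
    least : ∀ {W} → (∀ {Z} → Sandwiched F V Z → Z ⊆ W) → Y ⊆ W
    least = proj₂ Y-join

  M⊆Y : M ⊆ Y
  M⊆Y = upper (M∈ , btM)

  Y-Between : Between F V Y
  Y-Between =
    (λ B mB → ⊆-trans (proj₁ btM B mB) M⊆Y) , (λ A mA → least (λ (_ , btZ) → proj₂ btZ A mA))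

  Y∉F : ¬ Y ∈ F
  Y∉F Y∈ = X⊈M (subst (X ⊆_) (maxM Y Y∈ Y-Between M⊆Y) X⊆Y)
    where
    X⊆Y : X ⊆ Y
    X⊆Y = upper (InComponent⇒∈ cX , neither-bound⇒Between cX (λ below → X⊈M (below (M∈ , btM)))
                                                      (λ above → M⊈X (above (M∈ , btM))))

  comparable-Y : ∀ {W} → InComponent F V W → ¬ Incomparable W Y
  comparable-Y cW (W⊈Y , Y⊈W) = W⊈Y (upper (InComponent⇒∈ cW , neither-bound⇒Between cW
    (λ below → W⊈Y (⊆-trans (below (M∈ , btM)) M⊆Y)) (λ above → Y⊈W (least above))))

  A₀ : Subset n
  A₀ = proj₁ (maximal-above (here vV))

  A₀-maximal : MaximalIn F V A₀
  A₀-maximal = proj₁ (proj₂ (maximal-above (here vV)))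

  A₀-InComponent : InComponent F V A₀
  A₀-InComponent = proj₁ A₀-maximal

  Y⊆A₀ : Y ⊆ A₀
  Y⊆A₀ = proj₂ Y-Between A₀ A₀-maximal

  M-InComponent : InComponent F V M
  M-InComponent with B₀ , mB₀ , _ ← minimal-below (here vV) =
    InComponent-upward (proj₁ mB₀)
      (Vertex-between (Connected-target (proj₁ mB₀)) (Connected-target A₀-InComponent)
                      M∈ B₀⊆M (⊆-trans M⊆Y Y⊆A₀))
      B₀⊆M
    where
    B₀⊆M : B₀ ⊆ M
    B₀⊆M = proj₁ btM B₀ mB₀

  ∥Y⇒∥below : ∀ {U Z} → InComponent F V U → U ⊆ Y → Z ∈ F → Incomparable Z Y → Incomparable Z U
  ∥Y⇒∥below cU U⊆Y Z∈ Z∥Y =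
      (λ Z⊆U → proj₁ Z∥Y (⊆-trans Z⊆U U⊆Y))
    , (λ U⊆Z → comparable-Y (InComponent-upward cU (Incomparable⇒Vertex Z∈ Z∥Y) U⊆Z) Z∥Y)

  ∥Y⇒∥above : ∀ {U Z} → InComponent F V U → Y ⊆ U → Z ∈ F → Incomparable Z Y → Incomparable Z U
  ∥Y⇒∥above cU Y⊆U Z∈ Z∥Y =
      (λ Z⊆U → comparable-Y (InComponent-downward cU (Incomparable⇒Vertex Z∈ Z∥Y) Z⊆U) Z∥Y)
    , (λ U⊆Z → proj₂ Z∥Y (⊆-trans Y⊆U U⊆Z))

  no-N-through-Y : ¬ ContainsInducedN (Y ∷ F)
  no-N-through-Y
    (_ , _ , R , _ , here refl , Q∈ , R∈ , _ , Y≢Q , Y≢R , _ , _ , _ , _ , Y⊂R , Q⊂R , _ , Y∥Q , _ , R∥S) =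
    proj₁ (∥Y⇒∥above R-InComponent (p⊂q⇒p⊆q Y⊂R) (tail (Y≢Q ∘ sym) Q∈) (swap Y∥Q)) (p⊂q⇒p⊆q Q⊂R)
    where
    R-InComponent : InComponent F V R
    R-InComponent = InComponent-upward M-InComponent
      (Incomparable⇒Vertex (tail (Y≢R ∘ sym) R∈) R∥S) (⊆-trans M⊆Y (p⊂q⇒p⊆q Y⊂R))
  no-N-through-Y
    (_ , _ , _ , _ , there P∈ , here refl , R∈ , S∈ , _ , _ , _ , Y≢R , Y≢S , _ , P⊂R , Y⊂R , Y⊂S , P∥Y , P∥S , R∥S) =
    noN (inducedN P∈ M∈ (tail (Y≢R ∘ sym) R∈) (tail (Y≢S ∘ sym) S∈)
          P⊂R (⊆-⊂-trans M⊆Y Y⊂R) (⊆-⊂-trans M⊆Y Y⊂S) (∥Y⇒∥below M-InComponent M⊆Y P∈ P∥Y) P∥S R∥S)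
  no-N-through-Y
    (_ , _ , _ , S , there P∈ , there Q∈ , here refl , S∈ , _ , _ , _ , _ , _ , Y≢S , P⊂Y , Q⊂Y , Q⊂S , P∥Q , P∥S , Y∥S) =
    noN (inducedN P∈ Q∈ (InComponent⇒∈ A₀-InComponent) S∈F (⊂-⊆-trans P⊂Y Y⊆A₀) (⊂-⊆-trans Q⊂Y Y⊆A₀) Q⊂S
          P∥Q P∥S (swap (∥Y⇒∥above A₀-InComponent Y⊆A₀ S∈F (swap Y∥S))))
    where
    S∈F : S ∈ F
    S∈F = tail (Y≢S ∘ sym) S∈
  no-N-through-Y
    (_ , _ , _ , _ , there P∈ , there Q∈ , there R∈ , here refl , _ , _ , _ , _ , _ , _ , P⊂R , Q⊂R , Q⊂Y , P∥Q , P∥Y , R∥Y) =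
    noN (inducedN P∈ Q∈ R∈ (InComponent⇒∈ A₀-InComponent) P⊂R Q⊂R (⊂-⊆-trans Q⊂Y Y⊆A₀)
          P∥Q (∥Y⇒∥above A₀-InComponent Y⊆A₀ P∈ P∥Y) (∥Y⇒∥above A₀-InComponent Y⊆A₀ R∈ R∥Y))
  no-N-through-Y
    (P , Q , R , S , there P∈ , there Q∈ , there R∈ , there S∈ , distinct-and-induced) =
    noN (P , Q , R , S , P∈ , Q∈ , R∈ , S∈ , distinct-and-induced)

lemma2p6 : (n : ℕ) (𝓕 : Family n) → NSaturated 𝓕 →
    (V : Subset n) → Vertex 𝓕 V →
    (M : Subset n) → M ∈ 𝓕 → Between 𝓕 V M →
    ((M′ : Subset n) → M′ ∈ 𝓕 → Between 𝓕 V M′ → M ⊆ M′ → M′ ≡ M) →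
    (X : Subset n) → InComponent 𝓕 V X → X ⊆ M ⊎ M ⊆ X
lemma2p6 _ 𝓕 (noN , saturated) V vV M M∈ btM maxM X cX with X ⊆? M | M ⊆? X
... | yes X⊆M | _        = inj₁ X⊆M
... | no _    | yes M⊆X  = inj₂ M⊆X
... | no X⊈M  | no M⊈X   = ⊥-elim (¬¬-join (Between 𝓕 V) 𝓕 λ (Y , Y-join) →
  let open JoinOfSandwiched noN vV M∈ btM maxM cX X⊈M M⊈X Y-join
  in no-N-through-Y (saturated Y Y∉F))
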